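{- Let $m\ge1$ and $s$ be integers with $s\ge s_0:=\frac{1+\sqrt{1+8m}}{2}$, and let $\phi$ be a fixed injective function from $\{1,\dots,m\}$ to $D:=\{(i,j)\colon 1\le i<j\le s\}$ (which exists since $m\le\binom{s}{2}$). Let $G$ be the bipartite graph with parts $B=\{b_1,\dots,b_m\}$ and $R=\{r_1,\dots,r_{m+s}\}$ whose edges are: (i) $b_ir_i$ for every $i\in\{1,\dots,m\}$; and (ii) $b_ir_{m+i_1}$ and $b_ir_{m+i_2}$ for every $i\in\{1,\dots,m\}$, where $(i_1,i_2)=\phi(i)$. Let $\mathcal B$ be the set of $2$-subsets $A$ of $V(G)$ with $|R\cap A|$ even. Then $\beta(F_2(G))=|\mathcal B|$.
   Context: For a simple finite graph $G$, the $2$-token graph $F_2(G)$ is the graph whose vertices are all $2$-element subsets of $V(G)$, two such subsets being adjacent iff their symmetric difference is an edge of $G$. $\beta$ denotes the independence number. -}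

module Defs where

open import Data.Nat using (ℕ; _+_; _*_; _≤_; _<_)
open import Data.Nat.Divisibility using (_∣_)
open import Data.Fin using (Fin; toℕ; _↑ˡ_; _↑ʳ_)
open import Data.Bool using (Bool; true; false; if_then_else_)
open import Data.Product using (Σ; ∃; ∃-syntax; _×_; _,_; proj₁; proj₂)
open import Data.Sum using (_⊎_)
open import Data.List using (List; length)
open import Data.List.Membership.Propositional using (_∈_)
open import Data.List.Relation.Unary.Unique.Propositional using (Unique)
open import Relation.Nullary using (¬_)
open import Relation.Binary.PropositionalEquality using (_≡_)
open import Relation.Nullary.Decidable using (⌊_⌋)
open import Data.Nat.Properties using (_≤?_)

-- A 2-element subset {a,b} of Fin n, represented canonically with a < b.
Pair2 : ℕ → Set
Pair2 n = Σ (Fin n × Fin n) (λ p → toℕ (proj₁ p) < toℕ (proj₂ p))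

_∈₂_ : ∀ {n} → Fin n → Pair2 n → Set
x ∈₂ ((a , b) , _) = (x ≡ a) ⊎ (x ≡ b)

InSymDiff : ∀ {n} → Fin n → Pair2 n → Pair2 n → Set
InSymDiff x A B = ((x ∈₂ A) × ¬ (x ∈₂ B)) ⊎ (¬ (x ∈₂ A) × (x ∈₂ B))

TokenAdj : ∀ {n} → (Fin n → Fin n → Set) → Pair2 n → Pair2 n → Set
TokenAdj E A B =
  ∃[ u ] ∃[ v ] (E u v × (∀ x → (InSymDiff x A B → (x ≡ u) ⊎ (x ≡ v))
                               × ((x ≡ u) ⊎ (x ≡ v) → InSymDiff x A B)))

IndependentF2 : ∀ {n} → (Fin n → Fin n → Set) → List (Pair2 n) → Set
IndependentF2 E L =
  Unique L × (∀ A B → A ∈ L → B ∈ L → ¬ TokenAdj E A B)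

IndependenceNumberF2 : ∀ {n} → (Fin n → Fin n → Set) → ℕ → Set
IndependenceNumberF2 E k =
  (∃[ L ] (IndependentF2 E L × length L ≡ k))
  × (∀ L → IndependentF2 E L → length L ≤ k)

-- Vertices: Fin (m + (m + s)); b_i = i ↑ˡ (m + s)  (i : Fin m),
-- r_k = m ↑ʳ k  (k : Fin (m + s)); r_i (i ≤ m) is m ↑ʳ (i ↑ˡ s),
-- r_{m+j} (j ≤ s) is m ↑ʳ (m ↑ʳ j).
-- φ is given by its two coordinates φ₁ φ₂ : Fin m → Fin s.

bV : (m s : ℕ) → Fin m → Fin (m + (m + s))
bV m s i = i ↑ˡ (m + s)

rV : (m s : ℕ) → Fin (m + s) → Fin (m + (m + s))
rV m s k = m ↑ʳ k

data Arc (m s : ℕ) (φ₁ φ₂ : Fin m → Fin s) :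
         Fin (m + (m + s)) → Fin (m + (m + s)) → Set where
  e-own : ∀ i → Arc m s φ₁ φ₂ (bV m s i) (rV m s (i ↑ˡ s))
  e-φ₁  : ∀ i → Arc m s φ₁ φ₂ (bV m s i) (rV m s (m ↑ʳ φ₁ i))
  e-φ₂  : ∀ i → Arc m s φ₁ φ₂ (bV m s i) (rV m s (m ↑ʳ φ₂ i))

EdgeG : (m s : ℕ) (φ₁ φ₂ : Fin m → Fin s) →
        Fin (m + (m + s)) → Fin (m + (m + s)) → Set
EdgeG m s φ₁ φ₂ u v = Arc m s φ₁ φ₂ u v ⊎ Arc m s φ₁ φ₂ v u

isR : (m s : ℕ) → Fin (m + (m + s)) → ℕ
isR m s x = if ⌊ m ≤? toℕ x ⌋ then 1 else 0

InCalB : (m s : ℕ) → Pair2 (m + (m + s)) → Set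
InCalB m s ((a , b) , _) = 2 ∣ (isR m s a + isR m s b)

-- Colour B with 0 and R with 1, so that 𝓑 is the set of monochromatic
-- 2-subsets.  If A and B are token-adjacent then A △ B is an edge, which has
-- one end of each colour.  If A is monochromatic and contains the red end, A
-- is red, so the blue end lies in B; if B is monochromatic too, B is blue and
-- both its elements lie in A △ B, which has only one blue element.  Hence 𝓑
-- is independent.  Conversely every 2-subset outside 𝓑 is {b_i, r} with
-- r ∈ R, and sliding one token along a suitable edge matches these subsets
-- injectively to neighbours in 𝓑.  An independent set never contains both
-- ends of such a matching edge, so it injects into 𝓑.

module Submission where

open import Defs
open import Data.Nat using (ℕ; zero; suc; _+_; _*_; _∸_; _^_; _≤_; _<_; z≤n; s≤s)
open import Data.Nat.Properties using (_≤?_; m≤m+n; +-suc; +-monoʳ-<; <-≤-trans; <-asym; <⇒≱; <-irrelevant)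
open import Data.Nat.Divisibility using (_∣_; _∣?_; _∣0; ∣-refl; ∣1⇒≡1)
open import Data.Fin using (Fin; toℕ; _↑ˡ_; _↑ʳ_; splitAt; join) renaming (zero to fzero; suc to fsuc)
open import Data.Fin.Properties
  using (toℕ-↑ˡ; toℕ-↑ʳ; toℕ<n; splitAt-↑ˡ; splitAt-↑ʳ; splitAt-join; join-splitAt; splitAt⁻¹-↑ˡ; splitAt⁻¹-↑ʳ; <-cmp)
  renaming (_≟_ to _≟ᶠ_; <-irrefl to <ᶠ-irrefl)
open import Data.Product using (∃; ∃-syntax; ∃₂; _×_; _,_; proj₁; proj₂; -,_)
open import Data.Sum using (_⊎_; inj₁; inj₂; [_,_]′; reduce) renaming (swap to ⊎-swap)
open import Data.Bool using (true; false)
open import Data.Empty using (⊥-elim)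
open import Data.List using (List; []; _∷_; length; map; _++_; filter; allFin)
open import Data.List.Membership.Propositional using (_∈_)
open import Data.List.Membership.Propositional.Properties
  using (∈-map⁺; ∈-map⁻; ∈-++⁺ˡ; ∈-++⁺ʳ; ∈-++⁻; ∈-∃++; ∈-filter⁺; ∈-filter⁻; ∈-allFin)
open import Data.List.Properties using (length-++)
open import Data.List.Relation.Unary.Any using (here; there)
open import Data.List.Relation.Unary.All using () renaming (lookup to All-lookup)
open import Data.List.Relation.Unary.AllPairs using ([]; _∷_)
open import Data.List.Relation.Unary.Unique.Propositional using (Unique)
import Data.List.Relation.Unary.Unique.Propositional.Properties as Unique
open import Function using (_∘_)
open import Function.Bundles using (_⇔_; mk⇔; Equivalence)
open import Relation.Binary using (tri<; tri≈; tri>)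
open import Relation.Binary.PropositionalEquality
  using (_≡_; _≢_; refl; sym; trans; cong; cong₂; subst; subst₂)
open import Relation.Nullary using (¬_; yes; no; contradiction)
open import Relation.Nullary.Decidable using (⌊_⌋)
open import Relation.Unary using (Decidable)

∈-remove : ∀ {A : Set} {z w : A} (us vs : List A) → z ∈ us ++ w ∷ vs → z ≢ w → z ∈ us ++ vs
∈-remove us vs z∈ z≢w with ∈-++⁻ us z∈
... | inj₁ z∈us         = ∈-++⁺ˡ z∈us
... | inj₂ (here z≡w)   = contradiction z≡w z≢w
... | inj₂ (there z∈vs) = ∈-++⁺ʳ us z∈vs

module _ {A B : Set} where

  length-≤-by-injection : (h : A → B) {xs : List A} {ys : List B} → Unique xs →
    (∀ {x} → x ∈ xs → h x ∈ ys) →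
    (∀ {x y} → x ∈ xs → y ∈ xs → h x ≡ h y → x ≡ y) →
    length xs ≤ length ys
  length-≤-by-injection h {[]} _ _ _ = z≤n
  length-≤-by-injection h {x ∷ xs} (x∉xs ∷ xs!) into inj with ∈-∃++ (into (here refl))
  ... | us , vs , refl = subst (suc (length xs) ≤_) (sym length-split) (s≤s rest)
    where
    length-split : length (us ++ h x ∷ vs) ≡ suc (length (us ++ vs))
    length-split = trans (length-++ us) (trans (+-suc (length us) (length vs)) (cong suc (sym (length-++ us))))
    rest : length xs ≤ length (us ++ vs)
    rest = length-≤-by-injection h xs!
      (λ y∈ → ∈-remove us vs (into (there y∈))
                (λ hy≡hx → All-lookup x∉xs y∈ (sym (inj (there y∈) (here refl) hy≡hx))))
      (λ x∈ y∈ → inj (there x∈) (there y∈))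

module _ {V I : Set} (Adj : V → V → Set) (S : List V) (bad partner : I → V)
         (classify : ∀ x → x ∈ S ⊎ ∃ λ i → x ≡ bad i)
         (partner∈S : ∀ i → partner i ∈ S)
         (partner-adjacent : ∀ i → Adj (bad i) (partner i))
         (partner-injective : ∀ {i j} → partner i ≡ partner j → i ≡ j) where

  private
    send : ∀ x → x ∈ S ⊎ ∃ (λ i → x ≡ bad i) → V
    send x (inj₁ _)       = x
    send x (inj₂ (i , _)) = partner i

    send∈S : ∀ x c → send x c ∈ S
    send∈S x (inj₁ x∈S)     = x∈S
    send∈S x (inj₂ (i , _)) = partner∈S i

    send-injective : ∀ {L} → (∀ x y → x ∈ L → y ∈ L → ¬ Adj x y) →
      ∀ {x y} cx cy → x ∈ L → y ∈ L → send x cx ≡ send y cy → x ≡ y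
    send-injective _   (inj₁ _)          (inj₁ _)          _  _  x≡y = x≡y
    send-injective ind (inj₁ _)          (inj₂ (i , refl)) x∈ y∈ x≡p =
      ⊥-elim (ind _ _ y∈ x∈ (subst (Adj (bad i)) (sym x≡p) (partner-adjacent i)))
    send-injective ind (inj₂ (i , refl)) (inj₁ _)          x∈ y∈ p≡y =
      ⊥-elim (ind _ _ x∈ y∈ (subst (Adj (bad i)) p≡y (partner-adjacent i)))
    send-injective _   (inj₂ (i , refl)) (inj₂ (j , refl)) _  _  p≡p =
      cong bad (partner-injective p≡p)

  independent-length-≤ : ∀ L → Unique L → (∀ x y → x ∈ L → y ∈ L → ¬ Adj x y) →
                         length L ≤ length S
  independent-length-≤ L L! ind =
    length-≤-by-injection (λ x → send x (classify x)) L!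
      (λ {x} _ → send∈S x (classify x))
      (λ {x} {y} → send-injective ind (classify x) (classify y))

module _ {n : ℕ} where

  Pair2-≡ : ∀ {a b a′ b′ : Fin n} {p : toℕ a < toℕ b} {p′ : toℕ a′ < toℕ b′} →
            a ≡ a′ → b ≡ b′ → _≡_ {A = Pair2 n} ((a , b) , p) ((a′ , b′) , p′)
  Pair2-≡ {p = p} {p′} refl refl = cong (_ ,_) (<-irrelevant p p′)

  record _≐⟨_,_⟩ (A : Pair2 n) (x y : Fin n) : Set where
    field
      left∈  : x ∈₂ A
      right∈ : y ∈₂ A
      only   : ∀ w → w ∈₂ A → w ≡ x ⊎ w ≡ y
  open _≐⟨_,_⟩

  ≐-self : ∀ {a b p} → ((a , b) , p) ≐⟨ a , b ⟩
  ≐-self = record { left∈ = inj₁ refl ; right∈ = inj₂ refl ; only = λ _ w∈ → w∈ }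

  ≐-swap : ∀ {a b p} → ((a , b) , p) ≐⟨ b , a ⟩
  ≐-swap = record { left∈ = inj₂ refl ; right∈ = inj₁ refl ; only = λ _ → ⊎-swap }

  ≐-distinct : ∀ {A x y} → A ≐⟨ x , y ⟩ → x ≢ y
  ≐-distinct {(a , b) , a<b} A≐ refl =
    <ᶠ-irrefl (trans (reduce (only A≐ a (inj₁ refl))) (sym (reduce (only A≐ b (inj₂ refl))))) a<b

  SymDiffIs : Pair2 n → Pair2 n → Fin n → Fin n → Set
  SymDiffIs A B u v =
    ∀ x → (InSymDiff x A B → (x ≡ u) ⊎ (x ≡ v)) × ((x ≡ u) ⊎ (x ≡ v) → InSymDiff x A B)

  InSymDiff-sym : ∀ (x : Fin n) A B → InSymDiff x A B → InSymDiff x B A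
  InSymDiff-sym x A B (inj₁ (p , q)) = inj₂ (q , p)
  InSymDiff-sym x A B (inj₂ (p , q)) = inj₁ (q , p)

  SymDiffIs-sym : ∀ (A B : Pair2 n) {u v : Fin n} → SymDiffIs A B u v → SymDiffIs B A u v
  SymDiffIs-sym A B sd x = proj₁ (sd x) ∘ InSymDiff-sym x B A , InSymDiff-sym x A B ∘ proj₂ (sd x)

  token-move : ∀ {E : Fin n → Fin n → Set} {A B x y z} →
    A ≐⟨ x , y ⟩ → B ≐⟨ x , z ⟩ → y ≢ z → E y z → TokenAdj E A B
  token-move {A = A} {B} {x} {y} {z} A≐ B≐ y≢z yz = y , z , yz , λ w → to w , from w
    where
    to : ∀ w → InSymDiff w A B → w ≡ y ⊎ w ≡ z
    to w (inj₁ (w∈A , w∉B)) with only A≐ w w∈A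
    ... | inj₁ refl = contradiction (left∈ B≐) w∉B
    ... | inj₂ w≡y  = inj₁ w≡y
    to w (inj₂ (w∉A , w∈B)) with only B≐ w w∈B
    ... | inj₁ refl = contradiction (left∈ A≐) w∉A
    ... | inj₂ w≡z  = inj₂ w≡z
    from : ∀ w → w ≡ y ⊎ w ≡ z → InSymDiff w A B
    from w (inj₁ refl) =
      inj₁ (right∈ A≐ , [ ≐-distinct A≐ ∘ sym , y≢z ]′ ∘ only B≐ w)
    from w (inj₂ refl) =
      inj₂ ([ ≐-distinct B≐ ∘ sym , y≢z ∘ sym ]′ ∘ only A≐ w , right∈ B≐)

  module _ {C : Set} (c : Fin n → C) where

    Monochromatic : Pair2 n → Set
    Monochromatic ((a , b) , _) = c a ≡ c b

    monochromatic-∈ : ∀ A {x y} → Monochromatic A → x ∈₂ A → y ∈₂ A → c x ≡ c y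
    monochromatic-∈ _ mono (inj₁ refl) (inj₁ refl) = refl
    monochromatic-∈ _ mono (inj₁ refl) (inj₂ refl) = mono
    monochromatic-∈ _ mono (inj₂ refl) (inj₁ refl) = sym mono
    monochromatic-∈ _ mono (inj₂ refl) (inj₂ refl) = refl

    monochromatic-¬SymDiff-bichromaticˡ : ∀ A B {u v} →
      Monochromatic A → Monochromatic B → c u ≢ c v →
      SymDiffIs A B u v → ¬ v ∈₂ A
    monochromatic-¬SymDiff-bichromaticˡ A B@((b₁ , b₂) , b₁<b₂) {u} {v} monoA monoB cu≢cv sd v∈A =
      <ᶠ-irrefl (trans (member≡u (inj₁ refl)) (sym (member≡u (inj₂ refl)))) b₁<b₂
      where
      u∈B : u ∈₂ B
      u∈B with proj₂ (sd u) (inj₁ refl)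
      ... | inj₁ (u∈A , _) = contradiction (monochromatic-∈ A monoA u∈A v∈A) cu≢cv
      ... | inj₂ (_ , u∈B) = u∈B
      member≡u : ∀ {w} → w ∈₂ B → w ≡ u
      member≡u {w} w∈B with proj₁ (sd w) (inj₂ (w∉A , w∈B))
        where
        w∉A : ¬ w ∈₂ A
        w∉A w∈A = cu≢cv (trans (monochromatic-∈ B monoB u∈B w∈B) (monochromatic-∈ A monoA w∈A v∈A))
      ... | inj₁ w≡u = w≡u
      ... | inj₂ refl = contradiction (monochromatic-∈ B monoB u∈B w∈B) cu≢cv

    monochromatic-¬TokenAdj : ∀ {E : Fin n → Fin n → Set} {A B} →
      (∀ {u v} → E u v → c u ≢ c v) →
      Monochromatic A → Monochromatic B → ¬ TokenAdj E A B
    monochromatic-¬TokenAdj {A = A} {B} bichromatic monoA monoB (u , v , uv , sd)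
      with proj₂ (sd v) (inj₂ refl)
    ... | inj₁ (v∈A , _) =
      monochromatic-¬SymDiff-bichromaticˡ A B monoA monoB (bichromatic uv) sd v∈A
    ... | inj₂ (_ , v∈B) =
      monochromatic-¬SymDiff-bichromaticˡ B A monoB monoA (bichromatic uv) (SymDiffIs-sym A B sd) v∈B

pair₀ : ∀ {n} → Fin n → Pair2 (suc n)
pair₀ b = (fzero , fsuc b) , s≤s z≤n

liftPair : ∀ {n} → Pair2 n → Pair2 (suc n)
liftPair ((a , b) , a<b) = (fsuc a , fsuc b) , s≤s a<b

pairs : ∀ n → List (Pair2 n)
pairs zero    = []
pairs (suc n) = map pair₀ (allFin n) ++ map liftPair (pairs n)

pairs-unique : ∀ n → Unique (pairs n)
pairs-unique zero    = []
pairs-unique (suc n) =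
  Unique.++⁺ (Unique.map⁺ pair₀-injective (Unique.allFin⁺ n))
             (Unique.map⁺ liftPair-injective (pairs-unique n))
             disjoint
  where
  pair₀-injective : ∀ {a b : Fin n} → pair₀ a ≡ pair₀ b → a ≡ b
  pair₀-injective refl = refl
  liftPair-injective : ∀ {P Q : Pair2 n} → liftPair P ≡ liftPair Q → P ≡ Q
  liftPair-injective {(a , b) , _} {(.a , .b) , _} refl = refl
  disjoint : ∀ {P} → ¬ (P ∈ map pair₀ (allFin n) × P ∈ map liftPair (pairs n))
  disjoint (P∈₀ , P∈lift) with ∈-map⁻ pair₀ P∈₀ | ∈-map⁻ liftPair P∈lift
  ... | _ , _ , refl | _ , _ , ()

∈-pairs : ∀ n (P : Pair2 n) → P ∈ pairs n
∈-pairs (suc n) ((fzero  , fsuc b) , s≤s z≤n) = ∈-++⁺ˡ (∈-map⁺ pair₀ (∈-allFin b))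
∈-pairs (suc n) ((fsuc a , fsuc b) , s≤s a<b) =
  ∈-++⁺ʳ (map pair₀ (allFin n)) (∈-map⁺ liftPair (∈-pairs n ((a , b) , a<b)))

module Vertices (m s : ℕ) where

  N : ℕ
  N = m + (m + s)

  data Vertex : Set where
    b   : Fin m → Vertex
    red : Fin m ⊎ Fin s → Vertex

  -- b i, r i and r⁺ j are the paper's b_i, r_i and r_{m+j}.
  pattern r  i = red (inj₁ i)
  pattern r⁺ j = red (inj₂ j)

  vertex : Vertex → Fin N
  vertex (b i)   = bV m s i
  vertex (red k) = rV m s (join m s k)

  label : Fin N → Vertex
  label x = [ b , red ∘ splitAt m ]′ (splitAt m x)

  label-vertex : ∀ v → label (vertex v) ≡ v
  label-vertex (b i)   rewrite splitAt-↑ˡ m i (m + s)          = refl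
  label-vertex (red k) rewrite splitAt-↑ʳ m (m + s) (join m s k) = cong red (splitAt-join m s k)

  vertex-injective : ∀ {u v} → vertex u ≡ vertex v → u ≡ v
  vertex-injective {u} {v} e = trans (sym (label-vertex u)) (trans (cong label e) (label-vertex v))

  data Labelled : Fin N → Set where
    ⟨_⟩ : (v : Vertex) → Labelled (vertex v)

  labelled : ∀ x → Labelled x
  labelled x with splitAt m x in eq
  ... | inj₁ i = subst Labelled (splitAt⁻¹-↑ˡ eq) ⟨ b i ⟩
  ... | inj₂ k = subst Labelled (trans (cong (m ↑ʳ_) (join-splitAt m s k)) (splitAt⁻¹-↑ʳ eq))
                       ⟨ red (splitAt m k) ⟩

  rank : Vertex → ℕ
  rank (b i)  = toℕ i
  rank (r i)  = m + toℕ i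
  rank (r⁺ j) = m + (m + toℕ j)

  toℕ-vertex : ∀ v → toℕ (vertex v) ≡ rank v
  toℕ-vertex (b i)  = toℕ-↑ˡ i (m + s)
  toℕ-vertex (r i)  = trans (toℕ-↑ʳ m (i ↑ˡ s)) (cong (m +_) (toℕ-↑ˡ i s))
  toℕ-vertex (r⁺ j) = trans (toℕ-↑ʳ m (m ↑ʳ j)) (cong (m +_) (toℕ-↑ʳ m j))

  m≤rank-red : ∀ k → m ≤ rank (red k)
  m≤rank-red (inj₁ i) = m≤m+n m (toℕ i)
  m≤rank-red (inj₂ j) = m≤m+n m (m + toℕ j)

  _≺_ : Vertex → Vertex → Set
  u ≺ v = rank u < rank v

  ≺-toℕ : ∀ {u v} → toℕ (vertex u) < toℕ (vertex v) → u ≺ v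
  ≺-toℕ {u} {v} = subst₂ _<_ (toℕ-vertex u) (toℕ-vertex v)

  pair : ∀ u v → u ≺ v → Pair2 N
  pair u v u≺v = (vertex u , vertex v) , subst₂ _<_ (sym (toℕ-vertex u)) (sym (toℕ-vertex v)) u≺v

  b≺red : ∀ i k → b i ≺ red k
  b≺red i k = <-≤-trans (toℕ<n i) (m≤rank-red k)

  red⊀b : ∀ k i → ¬ red k ≺ b i
  red⊀b k i k≺i = <-asym k≺i (b≺red i k)

  badPair : Fin m × (Fin m ⊎ Fin s) → Pair2 N
  badPair (i , k) = pair (b i) (red k) (b≺red i k)

  colour : Vertex → ℕ
  colour (b _)   = 0
  colour (red _) = 1

  isR-vertex : ∀ v → isR m s (vertex v) ≡ colour v
  isR-vertex v with m ≤? toℕ (vertex v)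
  isR-vertex (b i)   | yes m≤i = contradiction (subst (m ≤_) (toℕ-vertex (b i)) m≤i) (<⇒≱ (toℕ<n i))
  isR-vertex (b i)   | no _    = refl
  isR-vertex (red k) | yes _   = refl
  isR-vertex (red k) | no m≰k  = contradiction (subst (m ≤_) (sym (toℕ-vertex (red k))) (m≤rank-red k)) m≰k

  isR-bit : ∀ x → isR m s x ≡ 0 ⊎ isR m s x ≡ 1
  isR-bit x with ⌊ m ≤? toℕ x ⌋
  ... | true  = inj₂ refl
  ... | false = inj₁ refl

  InCalB⇒monochromatic : ∀ A → InCalB m s A → Monochromatic (isR m s) A
  InCalB⇒monochromatic ((x , y) , _) 2∣ with isR-bit x | isR-bit y
  ... | inj₁ x≡0 | inj₁ y≡0 = trans x≡0 (sym y≡0)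
  ... | inj₂ x≡1 | inj₂ y≡1 = trans x≡1 (sym y≡1)
  ... | inj₁ x≡0 | inj₂ y≡1 with () ← ∣1⇒≡1 (subst (2 ∣_) (cong₂ _+_ x≡0 y≡1) 2∣)
  ... | inj₂ x≡1 | inj₁ y≡0 with () ← ∣1⇒≡1 (subst (2 ∣_) (cong₂ _+_ x≡1 y≡0) 2∣)

  2∣isR-vertices : ∀ u v → 2 ∣ colour u + colour v → 2 ∣ isR m s (vertex u) + isR m s (vertex v)
  2∣isR-vertices u v = subst (2 ∣_) (sym (cong₂ _+_ (isR-vertex u) (isR-vertex v)))

  classify : ∀ A → InCalB m s A ⊎ ∃ λ ik → A ≡ badPair ik
  classify ((x , y) , x<y) with labelled x | labelled y
  ... | ⟨ b i ⟩   | ⟨ b j ⟩   = inj₁ (2∣isR-vertices (b i) (b j) (2 ∣0))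
  ... | ⟨ b i ⟩   | ⟨ red k ⟩ = inj₂ ((i , k) , Pair2-≡ refl refl)
  ... | ⟨ red k ⟩ | ⟨ b i ⟩   = contradiction (≺-toℕ {red k} {b i} x<y) (red⊀b k i)
  ... | ⟨ red k ⟩ | ⟨ red l ⟩ = inj₁ (2∣isR-vertices (red k) (red l) ∣-refl)

  InCalB? : Decidable (InCalB m s)
  InCalB? ((x , y) , _) = 2 ∣? (isR m s x + isR m s y)

  𝓑 : List (Pair2 N)
  𝓑 = filter InCalB? (pairs N)

  𝓑-unique : Unique 𝓑
  𝓑-unique = Unique.filter⁺ InCalB? (pairs-unique N)

  ∈𝓑⇔InCalB : ∀ A → A ∈ 𝓑 ⇔ InCalB m s A
  ∈𝓑⇔InCalB A = mk⇔ (proj₂ ∘ ∈-filter⁻ InCalB? {xs = pairs N}) (∈-filter⁺ InCalB? (∈-pairs N A))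

module TokenGraph (m s : ℕ) (φ₁ φ₂ : Fin m → Fin s)
                  (φ< : ∀ i → toℕ (φ₁ i) < toℕ (φ₂ i))
                  (φ-injective : ∀ i j → φ₁ i ≡ φ₁ j → φ₂ i ≡ φ₂ j → i ≡ j) where

  open Vertices m s

  E : Fin N → Fin N → Set
  E = EdgeG m s φ₁ φ₂

  arc-colours : ∀ {u v} → Arc m s φ₁ φ₂ u v → isR m s u ≡ 0 × isR m s v ≡ 1
  arc-colours (e-own i) = isR-vertex (b i) , isR-vertex (r i)
  arc-colours (e-φ₁ i)  = isR-vertex (b i) , isR-vertex (r⁺ (φ₁ i))
  arc-colours (e-φ₂ i)  = isR-vertex (b i) , isR-vertex (r⁺ (φ₂ i))

  arc-bichromatic : ∀ {u v} → Arc m s φ₁ φ₂ u v → isR m s u ≢ isR m s v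
  arc-bichromatic uv e
    with () ← trans (sym (proj₁ (arc-colours uv))) (trans e (proj₂ (arc-colours uv)))

  edge-bichromatic : ∀ {u v} → E u v → isR m s u ≢ isR m s v
  edge-bichromatic (inj₁ uv) = arc-bichromatic uv
  edge-bichromatic (inj₂ vu) = arc-bichromatic vu ∘ sym

  𝓑-independent : ∀ A B → A ∈ 𝓑 → B ∈ 𝓑 → ¬ TokenAdj E A B
  𝓑-independent A B A∈ B∈ =
    monochromatic-¬TokenAdj (isR m s) {A = A} {B} edge-bichromatic
      (InCalB⇒monochromatic A (Equivalence.to (∈𝓑⇔InCalB A) A∈))
      (InCalB⇒monochromatic B (Equivalence.to (∈𝓑⇔InCalB B) B∈))

  -- Partner i k u v: the partner of {b i, red k} is {u, v}.  The φ-values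
  -- enter only through equations so that the indices stay constructor
  -- patterns, which makes Partner-unique a matter of unification.
  data Partner : Fin m → Fin m ⊎ Fin s → Vertex → Vertex → Set where
    own-up   : ∀ {i k} → toℕ i < toℕ k → Partner i (inj₁ k) (r i) (r k)
    own-self : ∀ {i j} → φ₁ i ≡ j → Partner i (inj₁ i) (r i) (r⁺ j)
    own-down : ∀ {i k} → toℕ k < toℕ i → Partner i (inj₁ k) (b k) (b i)
    shared-φ : ∀ {i j j′} → φ₁ i ≡ j → φ₂ i ≡ j′ → Partner i (inj₂ j) (r⁺ j) (r⁺ j′)
    shared   : ∀ {i j} → j ≢ φ₁ i → Partner i (inj₂ j) (r i) (r⁺ j)

  partner : ∀ i k → ∃₂ (Partner i k)
  partner i (inj₁ k) with <-cmp i k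
  ... | tri< i<k _ _  = -, -, own-up i<k
  ... | tri≈ _ refl _ = -, -, own-self refl
  ... | tri> _ _ k<i  = -, -, own-down k<i
  partner i (inj₂ j) with j ≟ᶠ φ₁ i
  ... | yes refl = -, -, shared-φ refl refl
  ... | no j≢φ₁i = -, -, shared j≢φ₁i

  r≺r⁺ : ∀ i j → r i ≺ r⁺ j
  r≺r⁺ i j = +-monoʳ-< m (<-≤-trans (toℕ<n i) (m≤m+n m (toℕ j)))

  Partner-≺ : ∀ {i k u v} → Partner i k u v → u ≺ v
  Partner-≺ (own-up i<k)             = +-monoʳ-< m i<k
  Partner-≺ (own-self _)             = r≺r⁺ _ _
  Partner-≺ (own-down k<i)           = k<i
  Partner-≺ (shared-φ {i} refl refl) = +-monoʳ-< m (+-monoʳ-< m (φ< i))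
  Partner-≺ (shared _)               = r≺r⁺ _ _

  Partner-unique : ∀ {i k i′ k′ u v} → Partner i k u v → Partner i′ k′ u v → (i , k) ≡ (i′ , k′)
  Partner-unique (own-up _)        (own-up _)     = refl
  Partner-unique (own-self _)      (own-self _)   = refl
  Partner-unique (own-self φ₁i≡j) (shared j≢φ₁i) = contradiction (sym φ₁i≡j) j≢φ₁i
  Partner-unique (own-down _)      (own-down _)   = refl
  Partner-unique (shared-φ {i} refl refl) (shared-φ {i′} φ₁i′≡ φ₂i′≡) =
    cong (_, inj₂ (φ₁ i)) (φ-injective i i′ (sym φ₁i′≡) (sym φ₂i′≡))
  Partner-unique (shared j≢φ₁i) (own-self φ₁i≡j) = contradiction (sym φ₁i≡j) j≢φ₁i
  Partner-unique (shared _)        (shared _)     = refl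

  slide : ∀ {i k u v} (p : Partner i k u v) {x y z} →
    badPair (i , k) ≐⟨ x , y ⟩ → pair u v (Partner-≺ p) ≐⟨ x , z ⟩ → E y z →
    TokenAdj E (badPair (i , k)) (pair u v (Partner-≺ p))
  slide _ A≐ B≐ yz = token-move A≐ B≐ (λ y≡z → edge-bichromatic yz (cong (isR m s) y≡z)) yz

  Partner-adjacent : ∀ {i k u v} (p : Partner i k u v) →
                     TokenAdj E (badPair (i , k)) (pair u v (Partner-≺ p))
  Partner-adjacent p@(own-up _)           = slide p ≐-swap ≐-swap (inj₁ (e-own _))
  Partner-adjacent p@(own-self refl)      = slide p ≐-swap ≐-self (inj₁ (e-φ₁ _))
  Partner-adjacent p@(own-down _)         = slide p ≐-self ≐-swap (inj₂ (e-own _))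
  Partner-adjacent p@(shared-φ refl refl) = slide p ≐-swap ≐-self (inj₁ (e-φ₂ _))
  Partner-adjacent p@(shared _)           = slide p ≐-swap ≐-swap (inj₁ (e-own _))

  partnerPair : ∀ {i k} → ∃₂ (Partner i k) → Pair2 N
  partnerPair (u , v , p) = pair u v (Partner-≺ p)

  partnerPair-injective : ∀ {i k i′ k′} (p : ∃₂ (Partner i k)) (p′ : ∃₂ (Partner i′ k′)) →
                          partnerPair p ≡ partnerPair p′ → (i , k) ≡ (i′ , k′)
  partnerPair-injective (u , v , p) (u′ , v′ , p′) e
    with refl ← vertex-injective {u} {u′} (cong (proj₁ ∘ proj₁) e)
       | refl ← vertex-injective {v} {v′} (cong (proj₂ ∘ proj₁) e)
    = Partner-unique p p′

  Partner-colours : ∀ {i k u v} → Partner i k u v → 2 ∣ colour u + colour v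
  Partner-colours (own-up _)     = ∣-refl
  Partner-colours (own-self _)   = ∣-refl
  Partner-colours (own-down _)   = 2 ∣0
  Partner-colours (shared-φ _ _) = ∣-refl
  Partner-colours (shared _)     = ∣-refl

  matched : Fin m × (Fin m ⊎ Fin s) → Pair2 N
  matched (i , k) = partnerPair (partner i k)

  matched∈𝓑 : ∀ ik → matched ik ∈ 𝓑
  matched∈𝓑 (i , k) with partner i k
  ... | u , v , p =
    Equivalence.from (∈𝓑⇔InCalB (pair u v (Partner-≺ p))) (2∣isR-vertices u v (Partner-colours p))

  independent⇒length≤𝓑 : ∀ L → IndependentF2 E L → length L ≤ length 𝓑
  independent⇒length≤𝓑 L (L! , ind) =
    independent-length-≤ (TokenAdj E) 𝓑 badPair matched
      (λ A → [ inj₁ ∘ Equivalence.from (∈𝓑⇔InCalB A) , inj₂ ]′ (classify A))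
      matched∈𝓑
      (λ (i , k) → Partner-adjacent (proj₂ (proj₂ (partner i k))))
      (λ {(i , k)} {(i′ , k′)} → partnerPair-injective (partner i k) (partner i′ k′))
      L L! ind

-- The numerical hypotheses only guarantee that an injective φ exists.
lemma4p2 : (m s : ℕ) → 1 ≤ m → 1 ≤ s → 1 + 8 * m ≤ (2 * s ∸ 1) ^ 2 →
    (φ₁ φ₂ : Fin m → Fin s) →
    (∀ i → toℕ (φ₁ i) < toℕ (φ₂ i)) →
    (∀ i j → φ₁ i ≡ φ₁ j → φ₂ i ≡ φ₂ j → i ≡ j) →
    ∃[ L ] (Unique L × (∀ A → (A ∈ L) ⇔ InCalB m s A)
            × IndependenceNumberF2 (EdgeG m s φ₁ φ₂) (length L))
lemma4p2 m s _ _ _ φ₁ φ₂ φ< φ-injective =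
  𝓑 , 𝓑-unique , ∈𝓑⇔InCalB , (𝓑 , (𝓑-unique , 𝓑-independent) , refl) , independent⇒length≤𝓑
  where
  open Vertices m s
  open TokenGraph m s φ₁ φ₂ φ< φ-injective
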